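{- Let $n\ge4$, $\mathbf{z}\in\mathcal{V}^{\bullet}_n$, $I=[\mathbf{0},\mathbf{z}]$, $\ell\in\{1,\dots,n-1\}$ and $k\in\{1,\dots,|A^{(\ell+1)}|\}$. Suppose that $I\langle A^{all}\cap I\rangle$ is (L)-shellable whenever $A^{all}\cap I\neq\emptyset$. Then $I\langle A^{(\ell+1)}_k\cap I\rangle$ is (L)-shellable whenever $A^{(\ell+1)}_k\cap I\neq\emptyset$.
   Context: $\mathbf{j}=(1,\dots,1)$. $(\mathcal{V}^{\bullet}_n,\preceq)$ has ground set $\{\mathbf{a}\in\mathbb{N}_0^n:\text{coordinate sum divisible by }n,\ \mathbf{a}\neq\mathbf{j}\}$ with $\mathbf{a}\preceq\mathbf{b}$ iff $\mathbf{a}\le\mathbf{b}$ coordinatewise and $\mathbf{b}-\mathbf{a}\neq\mathbf{j}$. $A^{all}$: atoms of $\mathcal{V}^{\bullet}_n$ (vectors with coordinate sum $n$ other than $\mathbf{j}$). $A^{(\ell)}=\{(\xi_1,\dots,\xi_n)\in A^{all}:(\xi_\ell,\dots,\xi_n)\ne\mathbf{0}\}$. $<^L$: lexicographic order on $A^{all}$ ($\mathbf{s}<^L\mathbf{t}$ iff at the first differing coordinate $\mathbf{s}$ is smaller). $A^{(\ell)}_k$: the $k$ smallest elements of $A^{(\ell)}$ in $<^L$. For a set $B$ of atoms, $I\langle B\rangle$ is the induced subposet of $I$ on $\{\mathbf{0}\}\cup\{\mathbf{b}\in I:\mathbf{b}\succeq\mathbf{a}\text{ for some }\mathbf{a}\in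 B\}$; $B\cap I$ denotes atoms of $B$ lying in $I$. A shelling order is an order of maximal chains such that whenever $c'$ precedes $c$ there is $c^*$ preceding $c$ with $c\cap c^*\supseteq c\cap c'$, $|c\,\Delta\,c^*|=2$. $I\langle B\rangle$ is (L)-shellable if it has a shelling order in which $c'$ precedes $c$ whenever the atom of $c'$ is strictly $<^L$-smaller than the atom of $c$. -}

module Defs where

open import Data.Nat using (ℕ; zero; suc; _+_; _∸_; _≤_; _<_; _≟_)
open import Data.Nat.Divisibility using (_∣_)
open import Data.Fin using (Fin; toℕ)
open import Data.Vec using (Vec; lookup; replicate; zipWith; sum)
import Data.Vec.Properties as VecP
open import Data.List using (List; []; _∷_; length; filter)
import Data.List
open import Data.List.Membership.Propositional using (_∈_; _∉_)
import Data.List.Membership.DecPropositional as DecMem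
open import Data.List.Relation.Unary.All using (All)
open import Data.List.Relation.Unary.AllPairs using (AllPairs)
open import Data.List.Relation.Unary.Unique.Propositional using (Unique)
open import Data.Product using (Σ; _×_; _,_; ∃; ∃-syntax)
open import Data.Sum using (_⊎_)
open import Relation.Nullary using (¬_; ¬?)
open import Relation.Binary.PropositionalEquality using (_≡_; _≢_)
open import Relation.Binary.Definitions using (DecidableEquality)

-- Points of ℕ₀^n, coordinates indexed by Fin n (coordinate i ↔ paper's i+1)
Pt : ℕ → Set
Pt n = Vec ℕ n

𝟘 : ∀ n → Pt n
𝟘 n = replicate n 0

𝕛 : ∀ n → Pt n
𝕛 n = replicate n 1

_≟ᵥ_ : ∀ {n} → DecidableEquality (Pt n)
_≟ᵥ_ = VecP.≡-dec _≟_

InV : ∀ n → Pt n → Set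
InV n a = (n ∣ sum a) × a ≢ 𝕛 n

_≤ᶜ_ : ∀ {n} → Pt n → Pt n → Set
a ≤ᶜ b = ∀ i → lookup a i ≤ lookup b i

_≼_ : ∀ {n} → Pt n → Pt n → Set
_≼_ {n} a b = (a ≤ᶜ b) × zipWith _∸_ b a ≢ 𝕛 n

_≺_ : ∀ {n} → Pt n → Pt n → Set
a ≺ b = (a ≼ b) × a ≢ b

InI : ∀ {n} → Pt n → Pt n → Set
InI {n} z x = InV n x × (𝟘 n ≼ x) × (x ≼ z)

Aall : ∀ n → Pt n → Set
Aall n a = (sum a ≡ n) × a ≢ 𝕛 n

-- A^(ℓ) (ℓ is 1-indexed): (ξ_ℓ,…,ξ_n) ≠ 0
Aℓ : ∀ n → ℕ → Pt n → Set
Aℓ n ℓ a = Aall n a × ¬ (∀ (i : Fin n) → ℓ ≤ suc (toℕ i) → lookup a i ≡ 0)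

_<L_ : ∀ {n} → Pt n → Pt n → Set
_<L_ {n} s t = ∃[ i ] ((∀ (j : Fin n) → toℕ j < toℕ i → lookup s j ≡ lookup t j)
                       × lookup s i < lookup t i)

HasCard : ∀ {n} → (Pt n → Set) → ℕ → Set
HasCard {n} P m = Σ (List (Pt n)) λ L →
  Unique L × (∀ x → x ∈ L → P x) × (∀ x → P x → x ∈ L) × length L ≡ m

-- A^(ℓ)_k : the k smallest elements of A^(ℓ) in <L, i.e. the elements of
-- A^(ℓ) having fewer than k lex-smaller elements of A^(ℓ)
Aℓk : ∀ n → ℕ → ℕ → Pt n → Set
Aℓk n ℓ k a = Aℓ n ℓ a × ∃[ m ] (HasCard (λ b → Aℓ n ℓ b × b <L a) m × m < k)

InSub : ∀ {n} → Pt n → (Pt n → Set) → Pt n → Set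
InSub {n} z B x = x ≡ 𝟘 n ⊎ (InI z x × ∃[ a ] ((B a × InI z a) × a ≼ x))

-- Chains are represented as strictly increasing lists (canonical listing of a
-- finite totally ordered subset).  Maximal chain of the induced subposet P:
MaxChain : ∀ {n} → (Pt n → Set) → List (Pt n) → Set
MaxChain {n} P c = All P c × AllPairs _≺_ c ×
  (∀ x → P x → (∀ y → y ∈ c → (x ≼ y ⊎ y ≼ x)) → x ∈ c)

symDiff : ∀ {n} → List (Pt n) → List (Pt n) → ℕ
symDiff {n} c d = length (filter (λ x → ¬? (x ∈? d)) c) + length (filter (λ x → ¬? (x ∈? c)) d)
  where open DecMem (_≟ᵥ_ {n}) using (_∈?_)

IsShellingOrder : ∀ {n} → (Pt n → Set) → List (List (Pt n)) → Set
IsShellingOrder {n} P L = Unique L × (∀ c → c ∈ L → MaxChain P c) × (∀ c → MaxChain P c → c ∈ L) ×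
  (∀ (i j : Fin (length L)) → toℕ i < toℕ j →
     ∃[ k ] (toℕ k < toℕ j ×
             (∀ x → x ∈ lookupL j → x ∈ lookupL i → x ∈ lookupL k) ×
             symDiff (lookupL j) (lookupL k) ≡ 2))
  where
    lookupL : Fin (length L) → List (Pt n)
    lookupL = Data.List.lookup L

-- the atom of a maximal chain 0 ⋖ a ⋖ … is its second element
data AtomOf {n} : List (Pt n) → Pt n → Set where
  atomOf : ∀ x a rest → AtomOf (x ∷ a ∷ rest) a

LShellable : ∀ {n} → (Pt n → Set) → Set
LShellable {n} P = Σ (List (List (Pt n))) λ L → IsShellingOrder P L ×
  (∀ (i j : Fin (length L)) → ∀ a' a →
     AtomOf (Data.List.lookup L i) a' → AtomOf (Data.List.lookup L j) a → a' <L a →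
     toℕ i < toℕ j)

-- The shelling of I⟨A^all ∩ I⟩ restricts to one of I⟨B ∩ I⟩, B = A^(ℓ+1)_k: keep, in order, the
-- maximal chains whose atom lies in B. These are exactly the maximal chains of I⟨B ∩ I⟩, because
-- below an atom there is only 0 and the atom itself. The shelling condition survives, except when
-- the witness c* for a pair has its atom a* outside B. Then c* arises from c = 0 ⋖ a ⋖ y ⋖ … by
-- exchanging a for a*, and a* <L a. Since B is an initial segment of A^(ℓ+1) for <L, a* vanishes
-- from coordinate ℓ+1 on, whereas a, hence y, has a positive coordinate q there. Moving one or two
-- units of a* into coordinate q yields an atom b ≼ y of A^(ℓ+1) with b <L a* <L a, so b ∈ B, and
-- 0 ⋖ b ⋖ y ⋖ … is an earlier chain that serves as the witness. That y covers b uses that y has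
-- coordinate sum 2n, which holds because for n ≥ 3 every longer gap can be split by an atom.

module Submission where

open import Defs
open import Data.Empty using (⊥-elim)
open import Data.Fin using (Fin; toℕ) renaming (zero to fzero; suc to fsuc)
open import Data.Fin.Properties as FinP using (toℕ-injective; ¬∀⟶∃¬)
open import Data.Nat using (ℕ; zero; suc; _+_; _*_; _∸_; _≤_; _<_; _≤?_; _<?_; z≤n; s≤s)
  renaming (_≟_ to _≟ℕ_)
open import Data.Nat.Divisibility using (_∣_; divides)
open import Data.Nat.Properties
open import Algebra.Properties.CommutativeSemigroup +-commutativeSemigroup
  using (interchange; xy∙z≈xz∙y)
open import Function using (_∘_; id)
open import Data.Product using (_×_; _,_; ∃-syntax; proj₁; proj₂)
open import Data.Sum using (_⊎_; inj₁; inj₂)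
open import Data.List as List using (List; []; _∷_; length; filter)
open import Data.List.Properties using (filter-notAll; filter-accept; filter-reject; filter-none)
import Data.List.Membership.DecPropositional as DecMembership
open import Data.List.Membership.Propositional using (_∈_; _∉_)
open import Data.List.Membership.Propositional.Properties using (∈-filter⁺; ∈-filter⁻; ∈-lookup)
open import Data.List.Membership.Propositional.Properties.WithK using (unique∧set⇒bag)
open import Data.List.Relation.Binary.BagAndSetEquality using (∼bag⇒↭)
open import Data.List.Relation.Binary.Permutation.Propositional.Properties using (↭-length)
open import Data.List.Relation.Unary.Any as Any using (Any; here; there)
open import Data.List.Relation.Unary.Any.Properties using (lookup-index)
open import Data.List.Relation.Unary.All as All using (All; []; _∷_)
open import Data.List.Relation.Unary.AllPairs as AllPairs using (AllPairs; []; _∷_)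
import Data.List.Relation.Unary.Unique.Propositional.Properties as Unique
open import Function.Bundles using (mk⇔)
open import Relation.Nullary.Decidable using (_×-dec_; _→-dec_)
open import Relation.Unary using (Decidable)
open import Data.Vec using ([]; _∷_; lookup; replicate; zipWith; sum; updateAt)
open import Data.Vec.Properties using (lookup-zipWith; lookup-replicate; lookup∘updateAt; lookup∘updateAt′)
open import Data.Vec.Relation.Binary.Pointwise.Extensional using (ext; Pointwise-≡⇒≡)
open import Relation.Binary.Definitions using (tri<; tri≈; tri>)
open import Relation.Binary.PropositionalEquality
open import Relation.Nullary using (¬_; Dec; yes; no; ¬?)

infixl 9 _!_

_!_ : ∀ {n} → Pt n → Fin n → ℕ
_!_ = lookup

module _ {n : ℕ} where

  lookup-≗⇒≡ : {u v : Pt n} → (∀ i → u ! i ≡ v ! i) → u ≡ v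
  lookup-≗⇒≡ h = Pointwise-≡⇒≡ (ext h)

  lookup-𝟘 : (i : Fin n) → 𝟘 n ! i ≡ 0
  lookup-𝟘 i = lookup-replicate i 0

  lookup-𝕛 : (i : Fin n) → 𝕛 n ! i ≡ 1
  lookup-𝕛 i = lookup-replicate i 1

  lookup-∸ : (b a : Pt n) (i : Fin n) → zipWith _∸_ b a ! i ≡ b ! i ∸ a ! i
  lookup-∸ b a i = lookup-zipWith _∸_ i b a

  𝟘≤ᶜ : (a : Pt n) → 𝟘 n ≤ᶜ a
  𝟘≤ᶜ a i = subst (_≤ a ! i) (sym (lookup-𝟘 i)) z≤n

  ≤ᶜ𝟘⇒≡𝟘 : {a : Pt n} → a ≤ᶜ 𝟘 n → a ≡ 𝟘 n
  ≤ᶜ𝟘⇒≡𝟘 {a} h = lookup-≗⇒≡ λ i → ≤-antisym (h i) (𝟘≤ᶜ a i)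

  ≢𝕛-at : (v : Pt n) (i : Fin n) → v ! i ≢ 1 → v ≢ 𝕛 n
  ≢𝕛-at v i v!i≢1 refl = v!i≢1 (lookup-𝕛 i)

  ≡𝕛⇒≡1 : {v : Pt n} → v ≡ 𝕛 n → ∀ i → v ! i ≡ 1
  ≡𝕛⇒≡1 refl = lookup-𝕛

  ∸≡𝕛⇒≡1 : (b a : Pt n) → zipWith _∸_ b a ≡ 𝕛 n → ∀ i → b ! i ∸ a ! i ≡ 1
  ∸≡𝕛⇒≡1 b a e i = trans (sym (lookup-∸ b a i)) (≡𝕛⇒≡1 e i)

  ∸≢𝕛-at : (b a : Pt n) (i : Fin n) → b ! i ∸ a ! i ≢ 1 → zipWith _∸_ b a ≢ 𝕛 n
  ∸≢𝕛-at b a i ne e = ne (∸≡𝕛⇒≡1 b a e i)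

sum-mono-≤ : ∀ {m} (u v : Pt m) → u ≤ᶜ v → sum u ≤ sum v
sum-mono-≤ []      []      h = z≤n
sum-mono-≤ (_ ∷ u) (_ ∷ v) h = +-mono-≤ (h fzero) (sum-mono-≤ u v (h ∘ fsuc))

sum-≡⇒≡ : ∀ {m} (u v : Pt m) → u ≤ᶜ v → sum u ≡ sum v → u ≡ v
sum-≡⇒≡ []      []      h e = refl
sum-≡⇒≡ (x ∷ u) (y ∷ v) h e with m≤n⇒m<n∨m≡n (h fzero)
... | inj₁ x<y  = ⊥-elim (<⇒≢ (+-mono-<-≤ x<y (sum-mono-≤ u v (h ∘ fsuc))) e)
... | inj₂ refl = cong (x ∷_) (sum-≡⇒≡ u v (h ∘ fsuc) (+-cancelˡ-≡ x _ _ e))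

sum-mono-< : ∀ {m} (u v : Pt m) → u ≤ᶜ v → u ≢ v → sum u < sum v
sum-mono-< u v h u≢v with m≤n⇒m<n∨m≡n (sum-mono-≤ u v h)
... | inj₁ lt = lt
... | inj₂ e  = ⊥-elim (u≢v (sum-≡⇒≡ u v h e))

sum-replicate : ∀ m c → sum (replicate m c) ≡ m * c
sum-replicate zero    c = refl
sum-replicate (suc m) c = cong (c +_) (sum-replicate m c)

sum-𝟘 : ∀ n → sum (𝟘 n) ≡ 0
sum-𝟘 n = trans (sum-replicate n 0) (*-zeroʳ n)

sum-𝕛 : ∀ n → sum (𝕛 n) ≡ n
sum-𝕛 n = trans (sum-replicate n 1) (*-identityʳ n)

sum-zipWith-+ : ∀ {m} (u v : Pt m) → sum (zipWith _+_ u v) ≡ sum u + sum v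
sum-zipWith-+ []      []      = refl
sum-zipWith-+ (x ∷ u) (y ∷ v) =
  trans (cong ((x + y) +_) (sum-zipWith-+ u v)) (interchange x y (sum u) (sum v))

sum-∸ : ∀ {n} (a b : Pt n) → a ≤ᶜ b → sum (zipWith _∸_ b a) + sum a ≡ sum b
sum-∸ {n} a b a≤b = begin
  sum (zipWith _∸_ b a) + sum a         ≡⟨ sum-zipWith-+ (zipWith _∸_ b a) a ⟨
  sum (zipWith _+_ (zipWith _∸_ b a) a) ≡⟨ cong sum (lookup-≗⇒≡ {u = zipWith _+_ (zipWith _∸_ b a) a} {b} coordinatewise) ⟩
  sum b                                 ∎
  where
  open ≡-Reasoning
  coordinatewise : ∀ i → zipWith _+_ (zipWith _∸_ b a) a ! i ≡ b ! i
  coordinatewise i = trans (lookup-zipWith _+_ i (zipWith _∸_ b a) a)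
                           (trans (cong (_+ a ! i) (lookup-∸ b a i)) (m∸n+n≡m (a≤b i)))

∸≡𝕛⇒sum≡ : ∀ {n} (a b : Pt n) → a ≤ᶜ b → zipWith _∸_ b a ≡ 𝕛 n → sum b ≡ sum a + n
∸≡𝕛⇒sum≡ {n} a b a≤b e = begin
  sum b                         ≡⟨ sum-∸ a b a≤b ⟨
  sum (zipWith _∸_ b a) + sum a ≡⟨ cong (λ v → sum v + sum a) e ⟩
  sum (𝕛 n) + sum a             ≡⟨ cong (_+ sum a) (sum-𝕛 n) ⟩
  n + sum a                     ≡⟨ +-comm n (sum a) ⟩
  sum a + n                     ∎
  where open ≡-Reasoning

sum-updateAt-+ : ∀ {m} (v : Pt m) (i : Fin m) t → sum (updateAt v i (_+ t)) ≡ sum v + t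
sum-updateAt-+ (x ∷ v) fzero    t = xy∙z≈xz∙y x t (sum v)
sum-updateAt-+ (x ∷ v) (fsuc i) t = trans (cong (x +_) (sum-updateAt-+ v i t)) (sym (+-assoc x (sum v) t))

sum-updateAt-∸ : ∀ {m} (v : Pt m) (i : Fin m) {t} → t ≤ v ! i → sum (updateAt v i (_∸ t)) + t ≡ sum v
sum-updateAt-∸ (x ∷ v) fzero    {t} t≤x = trans (xy∙z≈xz∙y (x ∸ t) (sum v) t) (cong (_+ sum v) (m∸n+n≡m t≤x))
sum-updateAt-∸ (x ∷ v) (fsuc i) {t} t≤ = trans (+-assoc x _ t) (cong (x +_) (sum-updateAt-∸ v i t≤))

positive-coordinate : ∀ {m} (v : Pt m) → 0 < sum v → ∃[ p ] 1 ≤ v ! p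
positive-coordinate (x ∷ v) pos with x ≟ℕ 0
... | no x≢0 = fzero , n≢0⇒n>0 x≢0
... | yes refl with positive-coordinate v pos
...   | p , 1≤v!p = fsuc p , 1≤v!p

support-besides : ∀ {m} (v : Pt m) (p : Fin m) → v ! p < sum v → ∃[ r ] (r ≢ p × 1 ≤ v ! r)
support-besides (x ∷ v) fzero x<x+sum with positive-coordinate v (+-cancelˡ-< x 0 (sum v) (subst (_< x + sum v) (sym (+-identityʳ x)) x<x+sum))
... | r , 1≤v!r = fsuc r , (λ ()) , 1≤v!r
support-besides (x ∷ v) (fsuc p) v!p<sum with x ≟ℕ 0
... | no x≢0 = fzero , (λ ()) , n≢0⇒n>0 x≢0
... | yes refl with support-besides v p v!p<sum
...   | r , r≢p , 1≤v!r = fsuc r , r≢p ∘ FinP.suc-injective , 1≤v!r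

-- The order of V•_n and its atoms

∣-<⇒+≤ : ∀ {n x y} → n ∣ x → n ∣ y → x < y → x + n ≤ y
∣-<⇒+≤ {n} (divides p refl) (divides q refl) px<qx =
  subst (_≤ q * n) (+-comm n (p * n)) (*-monoˡ-≤ n (*-cancelʳ-< n p q px<qx))

module _ {n : ℕ} where

  ≼-antisym : {a b : Pt n} → a ≼ b → b ≼ a → a ≡ b
  ≼-antisym (a≤b , _) (b≤a , _) = lookup-≗⇒≡ λ i → ≤-antisym (a≤b i) (b≤a i)

  ≺⇒sum< : {a b : Pt n} → a ≺ b → sum a < sum b
  ≺⇒sum< {a} {b} ((a≤b , _) , a≢b) = sum-mono-< a b a≤b a≢b

  ≼-refl : 0 < n → (a : Pt n) → a ≼ a
  ≼-refl 0<n a = (λ _ → ≤-refl) , λ e → <⇒≢ (m<m+n (sum a) 0<n) (∸≡𝕛⇒sum≡ a a (λ _ → ≤-refl) e)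

  ≼-trans : {a b c : Pt n} → n ∣ sum a → n ∣ sum b → a ≼ b → b ≼ c → a ≼ c
  ≼-trans {a} {b} {c} n∣a n∣b (a≤b , b∸a≢𝕛) b≼c@(b≤c , _) with m≤n⇒m<n∨m≡n (sum-mono-≤ a b a≤b)
  ... | inj₂ sa≡sb = subst (_≼ c) (sym (sum-≡⇒≡ a b a≤b sa≡sb)) b≼c
  ... | inj₁ sa<sb = a≤c , c∸a≢𝕛
    where
    a≤c : a ≤ᶜ c
    a≤c i = ≤-trans (a≤b i) (b≤c i)
    c∸a≢𝕛 : zipWith _∸_ c a ≢ 𝕛 n
    c∸a≢𝕛 e = b∸a≢𝕛 (subst (λ v → zipWith _∸_ v a ≡ 𝕛 n) (sym b≡c) e)
      where
      sum-c≤sum-b : sum c ≤ sum b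
      sum-c≤sum-b = subst (_≤ sum b) (sym (∸≡𝕛⇒sum≡ a c a≤c e)) (∣-<⇒+≤ n∣a n∣b sa<sb)
      b≡c : b ≡ c
      b≡c = sum-≡⇒≡ b c b≤c (≤-antisym (sum-mono-≤ b c b≤c) sum-c≤sum-b)

  ∸𝟘 : (a : Pt n) → zipWith _∸_ a (𝟘 n) ≡ a
  ∸𝟘 a = lookup-≗⇒≡ λ i → trans (lookup-∸ a (𝟘 n) i) (cong (a ! i ∸_) (lookup-𝟘 i))

  𝟘≼ : {a : Pt n} → a ≢ 𝕛 n → 𝟘 n ≼ a
  𝟘≼ {a} a≢𝕛 = 𝟘≤ᶜ a , λ e → a≢𝕛 (trans (sym (∸𝟘 a)) e)

  consecutive-ranks : {a x b : Pt n} → n ∣ sum a → n ∣ sum x → sum b ≡ sum a + n →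
                      a ≤ᶜ x → x ≤ᶜ b → x ≡ a ⊎ x ≡ b
  consecutive-ranks {a} {x} {b} n∣a n∣x sb a≤x x≤b with m≤n⇒m<n∨m≡n (sum-mono-≤ a x a≤x)
  ... | inj₂ sa≡sx = inj₁ (sym (sum-≡⇒≡ a x a≤x sa≡sx))
  ... | inj₁ sa<sx = inj₂ (sum-≡⇒≡ x b x≤b (≤-antisym (sum-mono-≤ x b x≤b) sum-b≤sum-x))
    where
    sum-b≤sum-x : sum b ≤ sum x
    sum-b≤sum-x = subst (_≤ sum x) (sym sb) (∣-<⇒+≤ n∣a n∣x sa<sx)

  atom-∈V : {a : Pt n} → Aall n a → InV n a
  atom-∈V (sa , a≢𝕛) = divides 1 (trans sa (sym (*-identityˡ n))) , a≢𝕛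

  atom-≢𝟘 : 0 < n → {a : Pt n} → Aall n a → a ≢ 𝟘 n
  atom-≢𝟘 0<n (sa , _) refl = <⇒≢ 0<n (trans (sym (sum-𝟘 n)) sa)

  atom-≼𝟘⇒⊥ : 0 < n → {a : Pt n} → Aall n a → ¬ (a ≼ 𝟘 n)
  atom-≼𝟘⇒⊥ 0<n A (a≤𝟘 , _) = atom-≢𝟘 0<n A (≤ᶜ𝟘⇒≡𝟘 a≤𝟘)

  atom-≼-atom⇒≡ : {a b : Pt n} → Aall n a → Aall n b → a ≼ b → a ≡ b
  atom-≼-atom⇒≡ {a} {b} (sa , _) (sb , _) (a≤b , _) = sum-≡⇒≡ a b a≤b (trans sa (sym sb))

  ≤ᶜ-atom⇒𝟘⊎≡ : {x a : Pt n} → n ∣ sum x → Aall n a → x ≤ᶜ a → x ≡ 𝟘 n ⊎ x ≡ a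
  ≤ᶜ-atom⇒𝟘⊎≡ {x} n∣x (sa , _) x≤a =
    consecutive-ranks (divides 0 (sum-𝟘 n)) n∣x (trans sa (cong (_+ n) (sym (sum-𝟘 n)))) (𝟘≤ᶜ x) x≤a

module _ {n : ℕ} where

  <L-irrefl : {a : Pt n} → ¬ (a <L a)
  <L-irrefl (_ , _ , lt) = <-irrefl refl lt

  <L-trans : {a b c : Pt n} → a <L b → b <L c → a <L c
  <L-trans (i , a≡b , ai<bi) (j , b≡c , bj<cj) with <-cmp (toℕ i) (toℕ j)
  ... | tri< i<j _ _ = i , (λ k k<i → trans (a≡b k k<i) (b≡c k (<-trans k<i i<j)))
                         , <-≤-trans ai<bi (≤-reflexive (b≡c i i<j))
  ... | tri> _ _ j<i = j , (λ k k<j → trans (a≡b k (<-trans k<j j<i)) (b≡c k k<j))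
                         , ≤-<-trans (≤-reflexive (a≡b j j<i)) bj<cj
  ... | tri≈ _ i≡j _ with toℕ-injective i≡j
  ...   | refl = i , (λ k k<i → trans (a≡b k k<i) (b≡c k k<i)) , <-trans ai<bi bj<cj

<L-∷ : ∀ {n} x {a b : Pt n} → a <L b → (x ∷ a) <L (x ∷ b)
<L-∷ x (i , a≡b , ai<bi) = fsuc i , agree , ai<bi
  where
  agree : ∀ j → toℕ j < suc (toℕ i) → (x ∷ _) ! j ≡ (x ∷ _) ! j
  agree fzero    _         = refl
  agree (fsuc j) (s≤s j<i) = a≡b j j<i

<L-trichotomy : ∀ {n} (a b : Pt n) → a ≢ b → a <L b ⊎ b <L a
<L-trichotomy []      []      a≢b = ⊥-elim (a≢b refl)
<L-trichotomy (x ∷ a) (y ∷ b) a≢b with <-cmp x y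
... | tri< x<y _ _ = inj₁ (fzero , (λ _ ()) , x<y)
... | tri> _ _ y<x = inj₂ (fzero , (λ _ ()) , y<x)
... | tri≈ _ refl _ with <L-trichotomy a b (a≢b ∘ cong (x ∷_))
...   | inj₁ a<b = inj₁ (<L-∷ x a<b)
...   | inj₂ b<a = inj₂ (<L-∷ x b<a)

_<L?_ : ∀ {n} (a b : Pt n) → Dec (a <L b)
a <L? b with a ≟ᵥ b
... | yes refl = no (<L-irrefl {a = a})
... | no a≢b with <L-trichotomy a b a≢b
...   | inj₁ a<b = yes a<b
...   | inj₂ b<a = no λ a<b → <L-irrefl {a = a} (<L-trans {a = a} {b} {a} a<b b<a)

module _ {n : ℕ} where

  Aall? : (a : Pt n) → Dec (Aall n a)
  Aall? a = (sum a ≟ℕ n) ×-dec ¬? (a ≟ᵥ 𝕛 n)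

  Aℓ? : ∀ ℓ (a : Pt n) → Dec (Aℓ n ℓ a)
  Aℓ? ℓ a = Aall? a ×-dec ¬? (FinP.all? λ i → (ℓ ≤? suc (toℕ i)) →-dec (a ! i ≟ℕ 0))

  HasCard-unique : {P : Pt n → Set} {m₁ m₂ : ℕ} → HasCard P m₁ → HasCard P m₂ → m₁ ≡ m₂
  HasCard-unique (L₁ , u₁ , sound₁ , complete₁ , refl) (L₂ , u₂ , sound₂ , complete₂ , refl) =
    ↭-length (∼bag⇒↭ (unique∧set⇒bag u₁ u₂ (mk⇔ (λ x∈ → complete₂ _ (sound₁ _ x∈)) (λ x∈ → complete₁ _ (sound₂ _ x∈)))))

  filter-HasCard : {P Q R : Pt n → Set} (Q? : Decidable Q) {m : ℕ} (hc : HasCard P m) →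
                   (∀ {x} → R x → P x × Q x) → (∀ {x} → P x → Q x → R x) →
                   HasCard R (length (filter Q? (proj₁ hc)))
  filter-HasCard {R = R} Q? (L , u , sound , complete , _) R⇒PQ PQ⇒R =
    filter Q? L , Unique.filter⁺ Q? u , sound′ , complete′ , refl
    where
    sound′ : ∀ x → x ∈ filter Q? L → R x
    sound′ x x∈ = let (x∈L , qx) = ∈-filter⁻ Q? {xs = L} x∈ in PQ⇒R (sound x x∈L) qx
    complete′ : ∀ x → R x → x ∈ filter Q? L
    complete′ x rx = let (px , qx) = R⇒PQ rx in ∈-filter⁺ Q? (complete x px) qx

  Aℓk-downward-closed : ∀ {ℓ k} {a b : Pt n} → Aℓk n ℓ k a → Aℓ n ℓ b → b <L a → Aℓk n ℓ k b
  Aℓk-downward-closed {ℓ} {k} {a} {b} (_ , m , hc@(L , _ , _ , complete , refl) , m<k) Ab b<a =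
    Ab , _ , filter-HasCard (_<L? b) hc R⇒PQ (λ (Ax , _) x<b → Ax , x<b) , <-trans fewer m<k
    where
    R⇒PQ : ∀ {x} → Aℓ n ℓ x × x <L b → (Aℓ n ℓ x × x <L a) × x <L b
    R⇒PQ {x} (Ax , x<b) = (Ax , <L-trans {a = x} {b} {a} x<b b<a) , x<b
    not-below-b : ∀ {xs} → b ∈ xs → Any (λ x → ¬ (x <L b)) xs
    not-below-b (here refl) = here (<L-irrefl {a = b})
    not-below-b (there b∈) = there (not-below-b b∈)
    fewer : length (filter (_<L? b) L) < length L
    fewer = filter-notAll (_<L? b) L (not-below-b (complete b (Ab , b<a)))

  lex-predecessors : ∀ {ℓ M} (hcA : HasCard (Aℓ n ℓ) M) (a : Pt n) →
                     HasCard (λ b → Aℓ n ℓ b × b <L a) (length (filter (_<L? a) (proj₁ hcA)))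
  lex-predecessors hcA a = filter-HasCard (_<L? a) hcA (λ r → r) _,_

  Aℓk? : ∀ ℓ k {M} → HasCard (Aℓ n ℓ) M → (a : Pt n) → Dec (Aℓk n ℓ k a)
  Aℓk? ℓ k hcA a with Aℓ? ℓ a
  ... | no ¬Aa = no (¬Aa ∘ proj₁)
  ... | yes Aa with length (filter (_<L? a) (proj₁ hcA)) <? k
  ...   | yes lt = yes (Aa , _ , lex-predecessors hcA a , lt)
  ...   | no ¬lt = no λ (_ , m , hc , m<k) → ¬lt (subst (_< k) (HasCard-unique hc (lex-predecessors hcA a)) m<k)

  -- Coordinates are indexed from 0, so A^(ℓ+1) asks for a positive coordinate of index ≥ ℓ.
  positive-tail : ∀ {ℓ} {a : Pt n} → Aℓ n (suc ℓ) a → ∃[ q ] (ℓ ≤ toℕ q × 1 ≤ a ! q)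
  positive-tail {ℓ} {a} (_ , ¬zero-tail)
    with ¬∀⟶∃¬ n _ (λ i → (suc ℓ ≤? suc (toℕ i)) →-dec (a ! i ≟ℕ 0)) ¬zero-tail
  ... | q , ¬[ℓ≤q⇒a!q≡0] with suc ℓ ≤? suc (toℕ q) | a ! q ≟ℕ 0
  ...   | no ℓ≰q    | _        = ⊥-elim (¬[ℓ≤q⇒a!q≡0] (⊥-elim ∘ ℓ≰q))
  ...   | yes _     | yes a!q≡0 = ⊥-elim (¬[ℓ≤q⇒a!q≡0] (λ _ → a!q≡0))
  ...   | yes ℓ≤q   | no a!q≢0  = q , ≤-pred ℓ≤q , n≢0⇒n>0 a!q≢0

  zero-tail : ∀ {ℓ} {a : Pt n} → Aall n a → ¬ Aℓ n (suc ℓ) a → ∀ i → ℓ ≤ toℕ i → a ! i ≡ 0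
  zero-tail {a = a} Aa ¬Aℓa i ℓ≤i with a ! i ≟ℕ 0
  ... | yes a!i≡0 = a!i≡0
  ... | no a!i≢0  = ⊥-elim (¬Aℓa (Aa , λ tail≡0 → a!i≢0 (tail≡0 i (s≤s ℓ≤i))))

-- Moving units between coordinates

third-index : ∀ {n} → 3 ≤ n → (p q : Fin n) → ∃[ r ] (r ≢ p × r ≢ q)
third-index (s≤s (s≤s (s≤s z≤n))) fzero           fzero           = fsuc fzero , (λ ()) , (λ ())
third-index (s≤s (s≤s (s≤s z≤n))) fzero           (fsuc fzero)    = fsuc (fsuc fzero) , (λ ()) , (λ ())
third-index (s≤s (s≤s (s≤s z≤n))) fzero           (fsuc (fsuc _)) = fsuc fzero , (λ ()) , (λ ())
third-index (s≤s (s≤s (s≤s z≤n))) (fsuc fzero)    fzero           = fsuc (fsuc fzero) , (λ ()) , (λ ())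
third-index (s≤s (s≤s (s≤s z≤n))) (fsuc fzero)    (fsuc _)        = fzero , (λ ()) , (λ ())
third-index (s≤s (s≤s (s≤s z≤n))) (fsuc (fsuc _)) fzero           = fsuc fzero , (λ ()) , (λ ())
third-index (s≤s (s≤s (s≤s z≤n))) (fsuc (fsuc _)) (fsuc _)        = fzero , (λ ()) , (λ ())

transfer : ∀ {n} → Pt n → Fin n → Fin n → ℕ → Pt n
transfer v p q t = updateAt (updateAt v p (_∸ t)) q (_+ t)

module _ {n : ℕ} (v : Pt n) {p q : Fin n} (q≢p : q ≢ p) (t : ℕ) where

  private
    drained : Pt n
    drained = updateAt v p (_∸ t)

  transfer-source : transfer v p q t ! p ≡ v ! p ∸ t
  transfer-source = trans (lookup∘updateAt′ p q {_+ t} (q≢p ∘ sym) drained) (lookup∘updateAt p {_∸ t} v)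

  transfer-target : transfer v p q t ! q ≡ v ! q + t
  transfer-target = trans (lookup∘updateAt q {_+ t} drained) (cong (_+ t) (lookup∘updateAt′ q p {_∸ t} q≢p v))

  transfer-other : ∀ i → i ≢ p → i ≢ q → transfer v p q t ! i ≡ v ! i
  transfer-other i i≢p i≢q = trans (lookup∘updateAt′ i q {_+ t} i≢q drained) (lookup∘updateAt′ i p {_∸ t} i≢p v)

  sum-transfer : t ≤ v ! p → sum (transfer v p q t) ≡ sum v
  sum-transfer t≤v!p = trans (sum-updateAt-+ drained q t) (sum-updateAt-∸ v p t≤v!p)

  transfer-≤ᶜ : {w : Pt n} → v ≤ᶜ w → v ! q + t ≤ w ! q → transfer v p q t ≤ᶜ w
  transfer-≤ᶜ {w} v≤w at-q i with i FinP.≟ p | i FinP.≟ q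
  ... | yes refl | _        = subst (_≤ w ! i) (sym transfer-source) (≤-trans (m∸n≤m _ t) (v≤w i))
  ... | no _     | yes refl = subst (_≤ w ! i) (sym transfer-target) at-q
  ... | no i≢p   | no i≢q   = subst (_≤ w ! i) (sym (transfer-other i i≢p i≢q)) (v≤w i)

  transfer-<L : toℕ p < toℕ q → 1 ≤ t → t ≤ v ! p → transfer v p q t <L v
  transfer-<L p<q 1≤t t≤v!p = p , agree , subst (_< v ! p) (sym transfer-source) (∸-monoʳ-< 1≤t t≤v!p)
    where
    agree : ∀ j → toℕ j < toℕ p → transfer v p q t ! j ≡ v ! j
    agree j j<p = transfer-other j (λ { refl → <-irrefl refl j<p }) (λ { refl → <-irrefl refl (<-trans j<p p<q) })

≤ᶜ-of-sum : ∀ {m} (d : Pt m) r → r ≤ sum d → ∃[ e ] (e ≤ᶜ d × sum e ≡ r)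
≤ᶜ-of-sum []      zero    _  = [] , (λ ()) , refl
≤ᶜ-of-sum {suc m} (x ∷ d) r r≤ with r ≤? x
... | yes r≤x = (r ∷ 𝟘 m) , bound , trans (cong (r +_) (sum-𝟘 m)) (+-identityʳ r)
  where
  bound : (r ∷ 𝟘 m) ≤ᶜ (x ∷ d)
  bound fzero    = r≤x
  bound (fsuc i) = 𝟘≤ᶜ d i
... | no r≰x with ≤ᶜ-of-sum d (r ∸ x) (m≤n+o⇒m∸n≤o r x r≤)
...   | e , e≤d , se = (x ∷ e) , bound , trans (cong (x +_) se) (m+[n∸m]≡n (<⇒≤ (≰⇒> r≰x)))
  where
  bound : (x ∷ e) ≤ᶜ (x ∷ d)
  bound fzero    = ≤-refl
  bound (fsuc i) = e≤d i

∸≡1⇒≡+1 : ∀ {m o} → o ≤ m → m ∸ o ≡ 1 → m ≡ o + 1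
∸≡1⇒≡+1 {m} {o} o≤m e = trans (sym (m+[n∸m]≡n o≤m)) (cong (o +_) e)

[m+1]∸[m∸1]≡2 : ∀ m → 1 ≤ m → (m + 1) ∸ (m ∸ 1) ≡ 2
[m+1]∸[m∸1]≡2 (suc zero)    _ = refl
[m+1]∸[m∸1]≡2 (suc (suc m)) _ = [m+1]∸[m∸1]≡2 (suc m) (s≤s z≤n)

module _ {n : ℕ} (3≤n : 3 ≤ n) where

  private
    0<n : 0 < n
    0<n = <-≤-trans (s≤s z≤n) 3≤n

  shift-below-slack : {e d : Pt n} → Aall n e → (∀ i → d ! i ≡ e ! i + 1) →
                      {p k : Fin n} → 1 ≤ e ! p → (k≢p : k ≢ p) → transfer e p k 1 ≢ 𝕛 n →
                      Aall n (transfer e p k 1) × transfer e p k 1 ≼ d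
  shift-below-slack {e} {d} (se , _) d≡e+1 {p} {k} 1≤e!p k≢p ≢𝕛 =
    (trans (sum-transfer e k≢p 1 1≤e!p) se , ≢𝕛) ,
    transfer-≤ᶜ e k≢p 1 {d} e≤d (≤-reflexive (sym (d≡e+1 k))) , ∸≢𝕛-at d _ p gap-at-p
    where
    e≤d : e ≤ᶜ d
    e≤d i = subst (e ! i ≤_) (sym (d≡e+1 i)) (m≤m+n _ 1)
    gap-at-p : d ! p ∸ transfer e p k 1 ! p ≢ 1
    gap-at-p eq = 1+n≢n (trans (sym ([m+1]∸[m∸1]≡2 (e ! p) 1≤e!p))
                          (trans (sym (cong₂ _∸_ (d≡e+1 p) (transfer-source e k≢p 1))) eq))

  atom-below-slack : {e d : Pt n} → Aall n e → (∀ i → d ! i ≡ e ! i + 1) → ∃[ b ] (Aall n b × b ≼ d)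
  atom-below-slack {e} {d} Ae@(se , _) d≡e+1 with positive-coordinate e (subst (0 <_) (sym se) 0<n)
  ... | p , 1≤e!p with third-index 3≤n p p
  ...   | k , k≢p , _ with transfer e p k 1 ≟ᵥ 𝕛 n
  ...     | no ≢𝕛 = _ , shift-below-slack Ae d≡e+1 1≤e!p k≢p ≢𝕛
  ...     | yes ≡𝕛 with third-index 3≤n p k
  ...       | r , r≢p , r≢k = _ , shift-below-slack Ae d≡e+1 1≤e!p r≢p (≢𝕛-at _ r 2≢1)
    where
    e!r≡1 : e ! r ≡ 1
    e!r≡1 = trans (sym (transfer-other e k≢p 1 r r≢p r≢k)) (≡𝕛⇒≡1 ≡𝕛 r)
    2≢1 : transfer e p r 1 ! r ≢ 1
    2≢1 eq = 1+n≢n (trans (sym (cong (_+ 1) e!r≡1)) (trans (sym (transfer-target e r≢p 1)) eq))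

  module _ {d : Pt n} (𝕛≤d : 𝕛 n ≤ᶜ d) {k p : Fin n} (2≤d!k : 2 ≤ d ! k) (k≢p : k ≢ p) where

    private
      e₁ : Pt n
      e₁ = transfer (𝕛 n) p k 1

      e₁!k≡2 : e₁ ! k ≡ 2
      e₁!k≡2 = trans (transfer-target (𝕛 n) k≢p 1) (cong (_+ 1) (lookup-𝕛 k))

      Ae₁ : Aall n e₁
      Ae₁ = trans (sum-transfer (𝕛 n) k≢p 1 (≤-reflexive (sym (lookup-𝕛 p)))) (sum-𝕛 n) ,
            ≢𝕛-at e₁ k (λ e → 1+n≢n (trans (sym e₁!k≡2) e))

      e₁≤d : e₁ ≤ᶜ d
      e₁≤d = transfer-≤ᶜ (𝕛 n) k≢p 1 {d} 𝕛≤d (subst (λ x → x + 1 ≤ d ! k) (sym (lookup-𝕛 k)) 2≤d!k)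

    pile-up-below : ∃[ b ] (Aall n b × b ≼ d)
    pile-up-below with zipWith _∸_ d e₁ ≟ᵥ 𝕛 n
    ... | no gap = e₁ , Ae₁ , e₁≤d , gap
    ... | yes no-gap with third-index 3≤n p k
    ...   | r , r≢p , r≢k = e₂ , Ae₂ , e₂≤d , ∸≢𝕛-at d e₂ k (λ e → 0≢1+n (trans (sym 3∸3) e))
      where
      d!k≡3 : d ! k ≡ 3
      d!k≡3 = trans (∸≡1⇒≡+1 (e₁≤d k) (∸≡𝕛⇒≡1 d e₁ no-gap k)) (cong (_+ 1) e₁!k≡2)
      k≢r : k ≢ r
      k≢r = r≢k ∘ sym
      e₂ : Pt n
      e₂ = transfer e₁ r k 1
      e₂!k≡3 : e₂ ! k ≡ 3
      e₂!k≡3 = trans (transfer-target e₁ k≢r 1) (cong (_+ 1) e₁!k≡2)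
      e₁!r≡1 : e₁ ! r ≡ 1
      e₁!r≡1 = trans (transfer-other (𝕛 n) k≢p 1 r r≢p r≢k) (lookup-𝕛 r)
      Ae₂ : Aall n e₂
      Ae₂ = trans (sum-transfer e₁ k≢r 1 (≤-reflexive (sym e₁!r≡1))) (proj₁ Ae₁) ,
            ≢𝕛-at e₂ k (λ e → 0≢1+n (sym (suc-injective (trans (sym e₂!k≡3) e))))
      e₂≤d : e₂ ≤ᶜ d
      e₂≤d = transfer-≤ᶜ e₁ k≢r 1 {d} e₁≤d (≤-reflexive (trans (cong (_+ 1) e₁!k≡2) (sym d!k≡3)))
      3∸3 : d ! k ∸ e₂ ! k ≡ 0
      3∸3 = cong₂ _∸_ d!k≡3 e₂!k≡3

  atom-below-𝕛+ : {d : Pt n} → 𝕛 n ≤ᶜ d → n + n ≤ sum d → ∃[ b ] (Aall n b × b ≼ d)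
  atom-below-𝕛+ {d} 𝕛≤d n+n≤ with ¬∀⟶∃¬ n (λ i → d ! i ≤ 𝕛 n ! i) (λ i → d ! i ≤? 𝕛 n ! i) d≰𝕛
    where
    d≰𝕛 : ¬ (d ≤ᶜ 𝕛 n)
    d≰𝕛 d≤𝕛 = <⇒≱ (m<m+n n 0<n) (≤-trans n+n≤ (subst (sum d ≤_) (sum-𝕛 n) (sum-mono-≤ d (𝕛 n) d≤𝕛)))
  ... | k , d!k≰1 with third-index 3≤n k k
  ...   | p , p≢k , _ = pile-up-below 𝕛≤d (subst (_< d ! k) (lookup-𝕛 k) (≰⇒> d!k≰1)) (p≢k ∘ sym)

  -- A greedy e ≤ d of coordinate sum n fails to be an atom below d only if e = 𝕛 or d − e = 𝕛;
  -- both cases are repaired by moving single units, for which three coordinates suffice.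
  split-off-atom : {d : Pt n} → n + n ≤ sum d → ∃[ b ] (Aall n b × b ≼ d)
  split-off-atom {d} n+n≤ with ≤ᶜ-of-sum d n (≤-trans (m≤m+n n n) n+n≤)
  ... | e , e≤d , se with e ≟ᵥ 𝕛 n
  ...   | yes refl = atom-below-𝕛+ e≤d n+n≤
  ...   | no e≢𝕛 with zipWith _∸_ d e ≟ᵥ 𝕛 n
  ...     | no d∸e≢𝕛 = e , (se , e≢𝕛) , e≤d , d∸e≢𝕛
  ...     | yes d∸e≡𝕛 = atom-below-slack (se , e≢𝕛) (λ i → ∸≡1⇒≡+1 (e≤d i) (∸≡𝕛⇒≡1 d e d∸e≡𝕛 i))

  rank₂-between : {a y : Pt n} → Aall n a → a ≤ᶜ y → n + n + n ≤ sum y →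
                  ∃[ x ] (a ≼ x × x ≼ y × sum x ≡ n + n)
  rank₂-between {a} {y} (sa , _) a≤y 3n≤ with split-off-atom n+n≤sum-d
    where
    n+n≤sum-d : n + n ≤ sum (zipWith _∸_ y a)
    n+n≤sum-d = +-cancelʳ-≤ n _ _ (subst (n + n + n ≤_) (trans (sym (sum-∸ a y a≤y)) (cong (sum (zipWith _∸_ y a) +_) sa)) 3n≤)
  ... | e , (se , e≢𝕛) , e≤d , d∸e≢𝕛 = x , (a≤x , x∸a≢𝕛) , (x≤y , y∸x≢𝕛) , trans (sum-zipWith-+ a e) (cong₂ _+_ sa se)
    where
    x : Pt n
    x = zipWith _+_ a e
    x!i : ∀ i → x ! i ≡ a ! i + e ! i
    x!i i = lookup-zipWith _+_ i a e
    a≤x : a ≤ᶜ x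
    a≤x i = subst (a ! i ≤_) (sym (x!i i)) (m≤m+n _ _)
    x∸a≢𝕛 : zipWith _∸_ x a ≢ 𝕛 n
    x∸a≢𝕛 eq = e≢𝕛 (trans (sym x∸a≡e) eq)
      where
      x∸a≡e : zipWith _∸_ x a ≡ e
      x∸a≡e = lookup-≗⇒≡ λ i → trans (lookup-∸ x a i) (trans (cong (_∸ a ! i) (x!i i)) (m+n∸m≡n (a ! i) (e ! i)))
    x≤y : x ≤ᶜ y
    x≤y i = subst₂ _≤_ (sym (x!i i)) (m+[n∸m]≡n (a≤y i)) (+-monoʳ-≤ (a ! i) (subst (e ! i ≤_) (lookup-∸ y a i) (e≤d i)))
    y∸x≢𝕛 : zipWith _∸_ y x ≢ 𝕛 n
    y∸x≢𝕛 eq = d∸e≢𝕛 (trans (sym y∸x≡d∸e) eq)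
      where
      y∸x≡d∸e : zipWith _∸_ y x ≡ zipWith _∸_ (zipWith _∸_ y a) e
      y∸x≡d∸e = lookup-≗⇒≡ λ i → begin
        zipWith _∸_ y x ! i                    ≡⟨ lookup-∸ y x i ⟩
        y ! i ∸ x ! i                          ≡⟨ cong (y ! i ∸_) (x!i i) ⟩
        y ! i ∸ (a ! i + e ! i)                ≡⟨ ∸-+-assoc (y ! i) (a ! i) (e ! i) ⟨
        (y ! i ∸ a ! i) ∸ e ! i                ≡⟨ cong (_∸ e ! i) (lookup-∸ y a i) ⟨
        zipWith _∸_ y a ! i ∸ e ! i            ≡⟨ lookup-∸ (zipWith _∸_ y a) e i ⟨
        zipWith _∸_ (zipWith _∸_ y a) e ! i    ∎
        where open ≡-Reasoning

-- The new atom is a* with one or two units moved into coordinate q; as a* vanishes from ℓ on,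
-- the first coordinate that changes decreases, so the result is lexicographically smaller.
module _ {n : ℕ} (3≤n : 3 ≤ n) {ℓ : ℕ} {a* y : Pt n} (Aa* : Aall n a*)
         (zero-tail : ∀ i → ℓ ≤ toℕ i → a* ! i ≡ 0) (a*≤y : a* ≤ᶜ y)
         {q : Fin n} (ℓ≤q : ℓ ≤ toℕ q) (1≤y!q : 1 ≤ y ! q) where

  ExchangedAtom : Set
  ExchangedAtom = ∃[ b ] (Aall n b × b ≼ y × b <L a* × 1 ≤ b ! q)

  private
    support-before-q : ∀ {p} → 1 ≤ a* ! p → toℕ p < toℕ q
    support-before-q {p} 1≤a*!p with ℓ ≤? toℕ p
    ... | yes ℓ≤p = ⊥-elim (<-irrefl (sym (zero-tail p ℓ≤p)) 1≤a*!p)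
    ... | no ℓ≰p = <-≤-trans (≰⇒> ℓ≰p) ℓ≤q

    q≢support : ∀ {p} → 1 ≤ a* ! p → q ≢ p
    q≢support 1≤a*!p refl = <-irrefl refl (support-before-q 1≤a*!p)

    transfer-at-q : ∀ {p} t (1≤a*!p : 1 ≤ a* ! p) → transfer a* p q t ! q ≡ t
    transfer-at-q t 1≤a*!p = trans (transfer-target a* (q≢support 1≤a*!p) t) (cong (_+ t) (zero-tail q ℓ≤q))

    by-transfer : ∀ {p} t → 1 ≤ t → t ≤ a* ! p → t ≤ y ! q →
                  transfer a* p q t ≢ 𝕛 n → zipWith _∸_ y (transfer a* p q t) ≢ 𝕛 n → ExchangedAtom
    by-transfer {p} t 1≤t t≤a*!p t≤y!q b≢𝕛 y∸b≢𝕛 =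
      transfer a* p q t ,
      (trans (sum-transfer a* q≢p t t≤a*!p) (proj₁ Aa*) , b≢𝕛) ,
      (transfer-≤ᶜ a* q≢p t {y} a*≤y (subst (λ x → x + t ≤ y ! q) (sym (zero-tail q ℓ≤q)) t≤y!q) , y∸b≢𝕛) ,
      transfer-<L a* q≢p t (support-before-q 1≤a*!p) 1≤t t≤a*!p ,
      subst (1 ≤_) (sym (transfer-at-q t 1≤a*!p)) 1≤t
      where
      1≤a*!p : 1 ≤ a* ! p
      1≤a*!p = ≤-trans 1≤t t≤a*!p
      q≢p : q ≢ p
      q≢p = q≢support 1≤a*!p

    by-double-transfer : ∀ {p} → 2 ≤ a* ! p → y ! q ≡ 2 → ExchangedAtom
    by-double-transfer {p} 2≤a*!p y!q≡2 =
      by-transfer 2 (s≤s z≤n) 2≤a*!p (≤-reflexive (sym y!q≡2))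
        (≢𝕛-at _ q (λ e → 1+n≢n (trans (sym (transfer-at-q 2 1≤a*!p)) e)))
        (∸≢𝕛-at y _ q (λ e → 0≢1+n (trans (sym (cong₂ _∸_ y!q≡2 (transfer-at-q 2 1≤a*!p))) e)))
      where
      1≤a*!p : 1 ≤ a* ! p
      1≤a*!p = ≤-trans (s≤s z≤n) 2≤a*!p

    y!q≡2 : ∀ {p} (1≤a*!p : 1 ≤ a* ! p) → zipWith _∸_ y (transfer a* p q 1) ≡ 𝕛 n → y ! q ≡ 2
    y!q≡2 1≤a*!p no-gap = ∸≡1⇒≡+1 {o = 1} 1≤y!q
      (trans (cong (_ ∸_) (sym (transfer-at-q 1 1≤a*!p))) (∸≡𝕛⇒≡1 y _ no-gap q))

    unit-coordinate : ∀ {p} → 1 ≤ a* ! p → ¬ (2 ≤ a* ! p) → a* ! p ≡ 1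
    unit-coordinate 1≤a*!p 2≰a*!p = ≤-antisym (≤-pred (≰⇒> 2≰a*!p)) 1≤a*!p

    tight : ∀ {p} → a* ! p ≡ 1 → y ! p ≡ 1 → y ! q ≡ 2 → ExchangedAtom
    tight {p} a*!p≡1 y!p≡1 y!q≡2 with support-besides a* p a*!p<sum
      where
      a*!p<sum : a* ! p < sum a*
      a*!p<sum = subst₂ _<_ (sym a*!p≡1) (sym (proj₁ Aa*)) (≤-trans (s≤s (s≤s z≤n)) 3≤n)
    ... | r , r≢p , 1≤a*!r with 2 ≤? a* ! r
    ...   | yes 2≤a*!r = by-double-transfer 2≤a*!r y!q≡2
    ...   | no 2≰a*!r = by-transfer 1 ≤-refl 1≤a*!r 1≤y!q
                          (≢𝕛-at _ r (λ e → 0≢1+n (trans (sym emptied-r) e)))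
                          (∸≢𝕛-at y _ p (λ e → 0≢1+n (trans (sym exhausted-p) e)))
      where
      q≢r : q ≢ r
      q≢r = q≢support 1≤a*!r
      emptied-r : transfer a* r q 1 ! r ≡ 0
      emptied-r = trans (transfer-source a* q≢r 1) (cong (_∸ 1) (unit-coordinate 1≤a*!r 2≰a*!r))
      exhausted-p : y ! p ∸ transfer a* r q 1 ! p ≡ 0
      exhausted-p = cong₂ _∸_ y!p≡1 (trans (transfer-other a* q≢r 1 p (r≢p ∘ sym) (q≢support (≤-reflexive (sym a*!p≡1)) ∘ sym)) a*!p≡1)

    unit-moved : ∀ {p} → 1 ≤ a* ! p → transfer a* p q 1 ≢ 𝕛 n → ExchangedAtom
    unit-moved {p} 1≤a*!p b≢𝕛 with zipWith _∸_ y (transfer a* p q 1) ≟ᵥ 𝕛 n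
    ... | no gap = by-transfer 1 ≤-refl 1≤a*!p 1≤y!q b≢𝕛 gap
    ... | yes no-gap with 2 ≤? a* ! p
    ...   | yes 2≤a*!p = by-double-transfer 2≤a*!p (y!q≡2 1≤a*!p no-gap)
    ...   | no 2≰a*!p = tight (unit-coordinate 1≤a*!p 2≰a*!p) y!p≡1 (y!q≡2 1≤a*!p no-gap)
      where
      y!p≡1 : y ! p ≡ 1
      y!p≡1 = trans (cong (y ! p ∸_) (sym (trans (transfer-source a* (q≢support 1≤a*!p) 1) (cong (_∸ 1) (unit-coordinate 1≤a*!p 2≰a*!p)))))
                    (∸≡𝕛⇒≡1 y _ no-gap p)

    module _ {p : Fin n} (1≤a*!p : 1 ≤ a* ! p) (moved≡𝕛 : transfer a* p q 1 ≡ 𝕛 n)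
             {r : Fin n} (r≢p : r ≢ p) (r≢q : r ≢ q) where

      a*!p≡2 : a* ! p ≡ 2
      a*!p≡2 = ∸≡1⇒≡+1 1≤a*!p (trans (sym (transfer-source a* (q≢support 1≤a*!p) 1)) (≡𝕛⇒≡1 moved≡𝕛 p))

      a*!r≡1 : a* ! r ≡ 1
      a*!r≡1 = trans (sym (transfer-other a* (q≢support 1≤a*!p) 1 r r≢p r≢q)) (≡𝕛⇒≡1 moved≡𝕛 r)

      1≤a*!r : 1 ≤ a* ! r
      1≤a*!r = ≤-reflexive (sym a*!r≡1)

      other-unit-moved : ExchangedAtom
      other-unit-moved with zipWith _∸_ y (transfer a* r q 1) ≟ᵥ 𝕛 n
      ... | no gap = by-transfer 1 ≤-refl 1≤a*!r 1≤y!q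
                       (≢𝕛-at _ p (λ e → 1+n≢n (trans (sym at-p) e))) gap
        where
        at-p : transfer a* r q 1 ! p ≡ 2
        at-p = trans (transfer-other a* (q≢support 1≤a*!r) 1 p (r≢p ∘ sym) (q≢support 1≤a*!p ∘ sym)) a*!p≡2
      ... | yes no-gap = by-double-transfer (≤-reflexive (sym a*!p≡2)) (y!q≡2 1≤a*!r no-gap)

  exchange-atom : ExchangedAtom
  exchange-atom with positive-coordinate a* (subst (0 <_) (sym (proj₁ Aa*)) (<-≤-trans (s≤s z≤n) 3≤n))
  ... | p , 1≤a*!p with transfer a* p q 1 ≟ᵥ 𝕛 n
  ...   | no moved≢𝕛 = unit-moved 1≤a*!p moved≢𝕛
  ...   | yes moved≡𝕛 with third-index 3≤n p q
  ...     | r , r≢p , r≢q = other-unit-moved 1≤a*!p moved≡𝕛 r≢p r≢q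

module _ {n : ℕ} where

  open DecMembership (_≟ᵥ_ {n}) using (_∈?_)

  outside : List (Pt n) → List (Pt n) → ℕ
  outside d xs = length (filter (λ x → ¬? (x ∈? d)) xs)

  outside-≥1 : ∀ {d xs} → Any (_∉ d) xs → 1 ≤ outside d xs
  outside-≥1 {d} {x ∷ xs} (here x∉d) = subst (1 ≤_) (sym (cong length (filter-accept (λ x → ¬? (x ∈? d)) {x} {xs} x∉d))) (s≤s z≤n)
  outside-≥1 {d} {x ∷ xs} (there any) with x ∈? d
  ... | yes _ = outside-≥1 any
  ... | no _  = s≤s z≤n

  outside-≥2 : ∀ {d h u v ys} → h ∈ d → u ∉ d → v ∉ d → 2 ≤ outside d (h ∷ u ∷ v ∷ ys)
  outside-≥2 {d} {h} {u} {v} {ys} h∈d u∉d v∉d = subst (2 ≤_) (sym (cong length kept)) (s≤s (s≤s z≤n))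
    where
    P? : Decidable (_∉ d)
    P? x = ¬? (x ∈? d)
    kept : filter P? (h ∷ u ∷ v ∷ ys) ≡ u ∷ v ∷ filter P? ys
    kept = trans (filter-reject P? (λ h∉d → h∉d h∈d))
                 (trans (filter-accept P? u∉d) (cong (u ∷_) (filter-accept P? v∉d)))

  outside-≡1 : ∀ {d h u ys} → h ∈ d → u ∉ d → All (_∈ d) ys → outside d (h ∷ u ∷ ys) ≡ 1
  outside-≡1 {d} {h} {u} {ys} h∈d u∉d ys⊆d = cong length kept
    where
    P? : Decidable (_∉ d)
    P? x = ¬? (x ∈? d)
    kept : filter P? (h ∷ u ∷ ys) ≡ u ∷ []
    kept = trans (filter-reject P? (λ h∉d → h∉d h∈d))
                 (trans (filter-accept P? u∉d) (cong (u ∷_) (filter-none P? (All.map (λ y∈d y∉d → y∉d y∈d) ys⊆d))))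

  symDiff-swap : ∀ {h u v ys} → u ∉ h ∷ v ∷ ys → v ∉ h ∷ u ∷ ys → symDiff (h ∷ u ∷ ys) (h ∷ v ∷ ys) ≡ 2
  symDiff-swap u∉ v∉ = cong₂ _+_ (outside-≡1 (here refl) u∉ ys⊆) (outside-≡1 (here refl) v∉ ys⊆)
    where
    ys⊆ : ∀ {h w ys} → All (_∈ h ∷ w ∷ ys) ys
    ys⊆ = All.tabulate (there ∘ there)

  symDiff-≥3 : ∀ {h u v ys d} → h ∈ d → u ∉ d → v ∉ d → Any (_∉ h ∷ u ∷ v ∷ ys) d → 3 ≤ symDiff (h ∷ u ∷ v ∷ ys) d
  symDiff-≥3 h∈d u∉d v∉d any = +-mono-≤ (outside-≥2 h∈d u∉d v∉d) (outside-≥1 any)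

module _ {A : Set} {Q : A → Set} (Q? : Decidable Q) where

  filter-index : (L : List A) → Fin (length (filter Q? L)) → Fin (length L)
  filter-index (x ∷ L) i with Q? x
  filter-index (x ∷ L) fzero    | yes _ = fzero
  filter-index (x ∷ L) (fsuc i) | yes _ = fsuc (filter-index L i)
  filter-index (x ∷ L) i        | no _  = fsuc (filter-index L i)

  lookup-filter : (L : List A) (i : Fin (length (filter Q? L))) →
                  List.lookup (filter Q? L) i ≡ List.lookup L (filter-index L i)
  lookup-filter (x ∷ L) i with Q? x
  lookup-filter (x ∷ L) fzero    | yes _ = refl
  lookup-filter (x ∷ L) (fsuc i) | yes _ = lookup-filter L i
  lookup-filter (x ∷ L) i        | no _  = lookup-filter L i

  filter-index-mono-< : (L : List A) (i j : Fin (length (filter Q? L))) →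
                        toℕ i < toℕ j → toℕ (filter-index L i) < toℕ (filter-index L j)
  filter-index-mono-< (x ∷ L) i j i<j with Q? x
  filter-index-mono-< (x ∷ L) fzero    (fsuc j) _         | yes _ = s≤s z≤n
  filter-index-mono-< (x ∷ L) (fsuc i) (fsuc j) (s≤s i<j) | yes _ = s≤s (filter-index-mono-< L i j i<j)
  filter-index-mono-< (x ∷ L) i        j        i<j       | no _  = s≤s (filter-index-mono-< L i j i<j)

  filter-index-cancel-< : (L : List A) (i j : Fin (length (filter Q? L))) →
                          toℕ (filter-index L i) < toℕ (filter-index L j) → toℕ i < toℕ j
  filter-index-cancel-< L i j lt with <-cmp (toℕ i) (toℕ j)
  ... | tri< i<j _ _ = i<j
  ... | tri> _ _ j<i = ⊥-elim (<-asym lt (filter-index-mono-< L j i j<i))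
  ... | tri≈ _ i≡j _ with toℕ-injective i≡j
  ...   | refl = ⊥-elim (<-irrefl refl lt)

  filter-index-surjective : (L : List A) (p : Fin (length L)) → Q (List.lookup L p) → ∃[ i ] filter-index L i ≡ p
  filter-index-surjective (x ∷ L) p qp with Q? x
  filter-index-surjective (x ∷ L) fzero    qp | yes _ = fzero , refl
  filter-index-surjective (x ∷ L) (fsuc p) qp | yes _ with filter-index-surjective L p qp
  ... | i , refl = fsuc i , refl
  filter-index-surjective (x ∷ L) fzero    qp | no ¬qx = ⊥-elim (¬qx qp)
  filter-index-surjective (x ∷ L) (fsuc p) qp | no _ with filter-index-surjective L p qp
  ... | i , refl = i , refl

-- Maximal chains of I⟨B ∩ I⟩

module Chains {n : ℕ} (0<n : 0 < n) (z : Pt n) (z∈V : InV n z) where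

  I⟨Aall⟩ : Pt n → Set
  I⟨Aall⟩ = InSub z (Aall n)

  Comparable : Pt n → List (Pt n) → Set
  Comparable x c = ∀ y → y ∈ c → x ≼ y ⊎ y ≼ x

  below-second-comparable : ∀ {x a rest} → n ∣ sum x → n ∣ sum a → 𝟘 n ≼ x → x ≼ a → All (a ≺_) rest →
                            Comparable x (𝟘 n ∷ a ∷ rest)
  below-second-comparable _   _   𝟘≼x _   _     _ (here refl)         = inj₂ 𝟘≼x
  below-second-comparable _   _   _   x≼a _     _ (there (here refl)) = inj₁ x≼a
  below-second-comparable n∣x n∣a _   x≼a a≺rest _ (there (there y∈)) =
    inj₁ (≼-trans n∣x n∣a x≼a (proj₁ (All.lookup a≺rest y∈)))

  atom-∉-chain : ∀ {a b rest} → Aall n a → Aall n b → b ≢ a → All (a ≺_) rest → b ∉ 𝟘 n ∷ a ∷ rest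
  atom-∉-chain _  Ab _   _     (here b≡𝟘)          = atom-≢𝟘 0<n Ab b≡𝟘
  atom-∉-chain _  _  b≢a _     (there (here b≡a))  = b≢a b≡a
  atom-∉-chain Aa Ab b≢a a≺rest (there (there b∈)) = b≢a (sym (atom-≼-atom⇒≡ Aa Ab (proj₁ (All.lookup a≺rest b∈))))

  module _ {B : Pt n → Set} where

    InSub-∣ : ∀ {x} → InSub z B x → n ∣ sum x
    InSub-∣ (inj₁ refl)                 = divides 0 (sum-𝟘 n)
    InSub-∣ (inj₂ ((x∈V , _ , _) , _)) = proj₁ x∈V

    InSub-𝟘≼ : ∀ {x} → InSub z B x → 𝟘 n ≼ x
    InSub-𝟘≼ (inj₁ refl)                  = ≼-refl 0<n (𝟘 n)
    InSub-𝟘≼ (inj₂ ((_ , 𝟘≼x , _) , _)) = 𝟘≼x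

    InSub-≼z : ∀ {x} → InSub z B x → x ≼ z
    InSub-≼z (inj₁ refl)                  = 𝟘≼ (proj₂ z∈V)
    InSub-≼z (inj₂ ((_ , _ , x≼z) , _)) = x≼z

    above-atom⇒InI : ∀ {a x} → InSub z B x → Aall n a → a ≼ x → InI z x
    above-atom⇒InI (inj₁ refl)      Aa a≼𝟘 = ⊥-elim (atom-≼𝟘⇒⊥ 0<n Aa a≼𝟘)
    above-atom⇒InI (inj₂ (x∈I , _)) _  _   = x∈I

    InSub-above : ∀ {a x} → B a → InI z a → InI z x → a ≼ x → InSub z B x
    InSub-above Ba a∈I x∈I a≼x = inj₂ (x∈I , _ , (Ba , a∈I) , a≼x)

    atom-∈InSub : ∀ {a} → B a → InI z a → InSub z B a
    atom-∈InSub {a} Ba a∈I = InSub-above Ba a∈I a∈I (≼-refl 0<n a)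

    InSub-map : ∀ {B′ : Pt n → Set} → (∀ {a} → B a → B′ a) → ∀ {x} → InSub z B x → InSub z B′ x
    InSub-map f (inj₁ x≡𝟘)                          = inj₁ x≡𝟘
    InSub-map f (inj₂ (x∈I , a , (Ba , a∈I) , a≼x)) = inj₂ (x∈I , a , (f Ba , a∈I) , a≼x)

  -- If sum y ≥ 3n, then rank₂-between provides an element strictly between a and y.
  maxChain-rank₂ : 3 ≤ n → ∀ {a y rest} → Aall n a → MaxChain I⟨Aall⟩ (𝟘 n ∷ a ∷ y ∷ rest) → sum y ≡ n + n
  maxChain-rank₂ 3≤n {a} {y} {rest} Aa@(sa , _) (_ ∷ a∈A ∷ y∈A ∷ rest∈A , _ ∷ (a≺y ∷ _) ∷ y≺rest ∷ _ , maximal)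
    with m≤n⇒m<n∨m≡n 2n≤sum-y
    where
    n∣y : n ∣ sum y
    n∣y = InSub-∣ y∈A
    2n≤sum-y : n + n ≤ sum y
    2n≤sum-y = subst (λ s → s + n ≤ sum y) sa (∣-<⇒+≤ (proj₁ (atom-∈V Aa)) n∣y (≺⇒sum< a≺y))
  ... | inj₂ 2n≡sum-y = sym 2n≡sum-y
  ... | inj₁ 2n<sum-y with rank₂-between 3≤n Aa (proj₁ (proj₁ a≺y)) (∣-<⇒+≤ n∣2n n∣y 2n<sum-y)
    where
    n∣y : n ∣ sum y
    n∣y = InSub-∣ y∈A
    n∣2n : n ∣ n + n
    n∣2n = divides 2 (cong (n +_) (sym (+-identityʳ n)))
  ...   | x , a≼x , x≼y , sum-x with maximal x x∈A comparable
    where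
    n∣x : n ∣ sum x
    n∣x = divides 2 (trans sum-x (cong (n +_) (sym (+-identityʳ n))))
    a∈I : InI z a
    a∈I = above-atom⇒InI a∈A Aa (≼-refl 0<n a)
    x≢𝕛 : x ≢ 𝕛 n
    x≢𝕛 refl = <⇒≢ (m<m+n n 0<n) (trans (sym (sum-𝕛 n)) sum-x)
    x∈A : I⟨Aall⟩ x
    x∈A = InSub-above Aa a∈I ((n∣x , x≢𝕛) , 𝟘≼ x≢𝕛 , ≼-trans n∣x (InSub-∣ y∈A) x≼y (InSub-≼z y∈A)) a≼x
    comparable : Comparable x (𝟘 n ∷ a ∷ y ∷ rest)
    comparable w (here refl)                 = inj₂ (𝟘≼ x≢𝕛)
    comparable w (there (here refl))         = inj₂ a≼x
    comparable w (there (there w∈))          =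
      below-second-comparable n∣x (InSub-∣ y∈A) (𝟘≼ x≢𝕛) x≼y y≺rest w (there w∈)
  ...     | here refl                    = ⊥-elim (<⇒≢ (≤-trans 0<n (m≤m+n n n)) (trans (sym (sum-𝟘 n)) sum-x))
  ...     | there (here refl)            = ⊥-elim (<⇒≢ (m<m+n n 0<n) (trans (sym sa) sum-x))
  ...     | there (there (here refl))    = ⊥-elim (<⇒≢ 2n<sum-y (sym sum-x))
  ...     | there (there (there x∈rest)) = ⊥-elim (proj₂ y≺x (≼-antisym (proj₁ y≺x) x≼y))
    where
    y≺x : y ≺ x
    y≺x = All.lookup y≺rest x∈rest

  module _ {B : Pt n → Set} (B⊆Aall : ∀ {a} → B a → Aall n a) where

    InSub-above-all : ∀ {a ws} → B a → InI z a → All I⟨Aall⟩ ws → All (a ≺_) ws → All (InSub z B) ws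
    InSub-above-all Ba a∈I []           []           = []
    InSub-above-all Ba a∈I (w∈A ∷ ws∈A) (a≺w ∷ a≺ws) =
      InSub-above Ba a∈I (above-atom⇒InI w∈A (B⊆Aall Ba) (proj₁ a≺w)) (proj₁ a≺w) ∷ InSub-above-all Ba a∈I ws∈A a≺ws

    restrict-maxChain : ∀ {a rest} → MaxChain I⟨Aall⟩ (𝟘 n ∷ a ∷ rest) → B a → MaxChain (InSub z B) (𝟘 n ∷ a ∷ rest)
    restrict-maxChain (_ ∷ a∈A ∷ rest∈A , ≺-chain@(_ ∷ a≺rest ∷ _) , maximal) Ba =
      inj₁ refl ∷ atom-∈InSub Ba a∈I ∷ InSub-above-all Ba a∈I rest∈A a≺rest , ≺-chain ,
      λ x x∈P → maximal x (InSub-map B⊆Aall x∈P)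
      where
      a∈I : InI z _
      a∈I = above-atom⇒InI a∈A (B⊆Aall Ba) (≼-refl 0<n _)

    module _ (nonempty : ∃[ a ] (B a × InI z a)) where

      private
        after-𝟘 : ∀ {t} → MaxChain (InSub z B) (𝟘 n ∷ t) → ∃[ a ] ∃[ rest ] (t ≡ a ∷ rest × B a × InI z a)
        after-𝟘 {[]} (_ , _ , maximal)
          with maximal _ (atom-∈InSub Ba₀ a₀∈I) (λ { _ (here refl) → inj₂ (proj₁ (proj₂ a₀∈I)) })
          where
          Ba₀ : B (proj₁ nonempty)
          Ba₀ = proj₁ (proj₂ nonempty)
          a₀∈I : InI z (proj₁ nonempty)
          a₀∈I = proj₂ (proj₂ nonempty)
        ... | here a₀≡𝟘 = ⊥-elim (atom-≢𝟘 0<n (B⊆Aall (proj₁ (proj₂ nonempty))) a₀≡𝟘)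
        after-𝟘 {a ∷ rest} (_ ∷ inj₁ a≡𝟘 ∷ _ , ((_ , 𝟘≢a) ∷ _) ∷ _ , _) = ⊥-elim (𝟘≢a (sym a≡𝟘))
        after-𝟘 {a ∷ rest} (_ ∷ inj₂ (a∈I , a₀ , (Ba₀ , a₀∈I) , a₀≼a) ∷ _ , _ ∷ (a≺rest ∷ _) , maximal)
          with maximal a₀ (atom-∈InSub Ba₀ a₀∈I)
                 (below-second-comparable n∣a₀ (proj₁ (proj₁ a∈I)) (proj₁ (proj₂ a₀∈I)) a₀≼a a≺rest)
          where
          n∣a₀ : n ∣ sum a₀
          n∣a₀ = proj₁ (atom-∈V (B⊆Aall Ba₀))
        ... | here a₀≡𝟘            = ⊥-elim (atom-≢𝟘 0<n (B⊆Aall Ba₀) a₀≡𝟘)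
        ... | there (here refl)     = a , rest , refl , Ba₀ , a∈I
        ... | there (there a₀∈rest) = ⊥-elim (proj₂ a≺a₀ (≼-antisym (proj₁ a≺a₀) a₀≼a))
          where
          a≺a₀ : a ≺ a₀
          a≺a₀ = All.lookup a≺rest a₀∈rest

      maxChain-shape : ∀ {c} → MaxChain (InSub z B) c → ∃[ a ] ∃[ rest ] (c ≡ 𝟘 n ∷ a ∷ rest × B a × InI z a)
      maxChain-shape {[]} (_ , _ , maximal) with maximal (𝟘 n) (inj₁ refl) (λ _ ())
      ... | ()
      maxChain-shape {h ∷ t} mc@(inP , h≺t ∷ _ , maximal)
        with maximal (𝟘 n) (inj₁ refl) (λ y y∈ → inj₁ (InSub-𝟘≼ (All.lookup inP y∈)))
      ... | there 𝟘∈t = ⊥-elim (proj₂ h≺𝟘 (≤ᶜ𝟘⇒≡𝟘 (proj₁ (proj₁ h≺𝟘))))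
        where
        h≺𝟘 : h ≺ 𝟘 n
        h≺𝟘 = All.lookup h≺t 𝟘∈t
      ... | here refl with after-𝟘 mc
      ...   | a , rest , refl , Ba , a∈I = a , rest , refl , Ba , a∈I

      maxChain-∋z : ∀ {c} → MaxChain (InSub z B) c → z ∈ c
      maxChain-∋z (inP , _ , maximal) = maximal z z∈P (λ y y∈ → inj₂ (InSub-≼z (All.lookup inP y∈)))
        where
        z∈P : InSub z B z
        z∈P = InSub-above (proj₁ (proj₂ nonempty)) (proj₂ (proj₂ nonempty))
                (z∈V , 𝟘≼ (proj₂ z∈V) , ≼-refl 0<n z) (proj₂ (proj₂ (proj₂ (proj₂ nonempty))))

      extend-maxChain : ∀ {c} → MaxChain (InSub z B) c → MaxChain I⟨Aall⟩ c
      extend-maxChain mc@(inP , ≺-chain , maximal) with maxChain-shape mc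
      ... | a , rest , refl , Ba , a∈I = All.map (InSub-map B⊆Aall) inP , ≺-chain , maximal′
        where
        maximal′ : ∀ x → I⟨Aall⟩ x → Comparable x (𝟘 n ∷ a ∷ rest) → x ∈ 𝟘 n ∷ a ∷ rest
        maximal′ x (inj₁ x≡𝟘) _ = here x≡𝟘
        maximal′ x (inj₂ (x∈I , _)) comparable with comparable a (there (here refl))
        ... | inj₂ a≼x = maximal x (InSub-above Ba a∈I x∈I a≼x) comparable
        ... | inj₁ x≼a with ≤ᶜ-atom⇒𝟘⊎≡ (proj₁ (proj₁ x∈I)) (B⊆Aall Ba) (proj₁ x≼a)
        ...   | inj₁ x≡𝟘 = here x≡𝟘
        ...   | inj₂ x≡a = there (here x≡a)

    replace-atom : 3 ≤ n → ∀ {a b y rest} → Aall n a → MaxChain I⟨Aall⟩ (𝟘 n ∷ a ∷ y ∷ rest) →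
                   B b → InI z b → b ≼ y → b ≢ a → MaxChain (InSub z B) (𝟘 n ∷ b ∷ y ∷ rest)
    replace-atom 3≤n {a} {b} {y} {rest} Aa mc@(_ ∷ _ ∷ y∈A ∷ rest∈A , (_ ∷ 𝟘≺y∷rest) ∷ (a≺y ∷ _) ∷ y≺rest ∷ ≺-rest , maximal)
                 Bb b∈I b≼y b≢a =
      inj₁ refl ∷ atom-∈InSub Bb b∈I ∷ InSub-above-all Bb b∈I (y∈A ∷ rest∈A) (b≺y ∷ b≺rest) ,
      (𝟘≺b ∷ 𝟘≺y∷rest) ∷ (b≺y ∷ b≺rest) ∷ y≺rest ∷ ≺-rest ,
      maximal′
      where
      Ab : Aall n b
      Ab = B⊆Aall Bb
      n∣b : n ∣ sum b
      n∣b = proj₁ (atom-∈V Ab)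
      n∣y : n ∣ sum y
      n∣y = InSub-∣ y∈A
      sum-y : sum y ≡ sum b + n
      sum-y = trans (maxChain-rank₂ 3≤n Aa mc) (cong (_+ n) (sym (proj₁ Ab)))
      𝟘≺b : 𝟘 n ≺ b
      𝟘≺b = 𝟘≼ (proj₂ Ab) , atom-≢𝟘 0<n Ab ∘ sym
      b≺y : b ≺ y
      b≺y = b≼y , λ b≡y → <⇒≢ (m<m+n (sum b) 0<n) (trans (cong sum b≡y) sum-y)
      b≺rest : All (b ≺_) rest
      b≺rest = All.map (λ y≺w → ≼-trans n∣b n∣y b≼y (proj₁ y≺w) , λ b≡w → proj₂ y≺w (≼-antisym (proj₁ y≺w) (subst (_≼ y) b≡w b≼y))) y≺rest
      maximal′ : ∀ x → InSub z B x → Comparable x (𝟘 n ∷ b ∷ y ∷ rest) → x ∈ 𝟘 n ∷ b ∷ y ∷ rest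
      maximal′ x x∈P comparable with comparable b (there (here refl))
      ... | inj₁ x≼b with ≤ᶜ-atom⇒𝟘⊎≡ (InSub-∣ x∈P) Ab (proj₁ x≼b)
      ...   | inj₁ x≡𝟘 = here x≡𝟘
      ...   | inj₂ x≡b = there (here x≡b)
      maximal′ x x∈P comparable | inj₂ b≼x with comparable y (there (there (here refl)))
      ... | inj₁ x≼y with consecutive-ranks n∣b (InSub-∣ x∈P) sum-y (proj₁ b≼x) (proj₁ x≼y)
      ...   | inj₁ x≡b = there (here x≡b)
      ...   | inj₂ x≡y = there (there (here x≡y))
      maximal′ x x∈P comparable | inj₂ b≼x | inj₂ y≼x with maximal x (InSub-map B⊆Aall x∈P) comparable-old
        where
        comparable-old : Comparable x (𝟘 n ∷ a ∷ y ∷ rest)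
        comparable-old w (here w≡𝟘)        = comparable w (here w≡𝟘)
        comparable-old w (there (here refl)) = inj₂ (≼-trans (proj₁ (atom-∈V Aa)) n∣y (proj₁ a≺y) y≼x)
        comparable-old w (there (there w∈)) = comparable w (there (there w∈))
      ... | here x≡𝟘 = here x≡𝟘
      ... | there (here refl) = ⊥-elim (b≢a (atom-≼-atom⇒≡ Ab Aa b≼x))
      ... | there (there x∈) = there (there x∈)

  open DecMembership (_≟ᵥ_ {n}) using (_∈?_)

  adjacent-maxChains : ∀ {a a* rest rest*} → Aall n a → Aall n a* → a ≢ a* →
                       MaxChain I⟨Aall⟩ (𝟘 n ∷ a ∷ rest) → MaxChain I⟨Aall⟩ (𝟘 n ∷ a* ∷ rest*) →
                       symDiff (𝟘 n ∷ a ∷ rest) (𝟘 n ∷ a* ∷ rest*) ≡ 2 →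
                       ∃[ y ] ∃[ rest′ ] (rest ≡ y ∷ rest′ × a* ≼ y)
  adjacent-maxChains {a} {a*} {rest} Aa Aa* a≢a* mc@(_ ∷ a∈A ∷ _ , _ ∷ (a≺rest ∷ _) , _)
                     mc*@(_ , _ ∷ (a*≺rest* ∷ _) , _) sd = after-atom rest mc a≺rest sd
    where
    a∈I : InI z a
    a∈I = above-atom⇒InI a∈A Aa (≼-refl 0<n a)
    a∉c* : a ∉ 𝟘 n ∷ a* ∷ _
    a∉c* = atom-∉-chain Aa* Aa a≢a* a*≺rest*
    after-atom : ∀ rest → MaxChain I⟨Aall⟩ (𝟘 n ∷ a ∷ rest) → All (a ≺_) rest →
                 symDiff (𝟘 n ∷ a ∷ rest) (𝟘 n ∷ a* ∷ _) ≡ 2 → ∃[ y ] ∃[ rest′ ] (rest ≡ y ∷ rest′ × a* ≼ y)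
    after-atom [] mc _ _ with maxChain-∋z id (a , Aa , a∈I) mc
    ... | here z≡𝟘 = ⊥-elim (atom-≼𝟘⇒⊥ 0<n Aa (subst (a ≼_) z≡𝟘 (proj₂ (proj₂ a∈I))))
    ... | there (here z≡a) = ⊥-elim (a∉c* (subst (_∈ _) z≡a (maxChain-∋z id (a , Aa , a∈I) mc*)))
    after-atom (y ∷ rest′) _ a≺y∷rest′@(a≺y ∷ _) sd with y ∈? (𝟘 n ∷ a* ∷ _)
    ... | no y∉c* = ⊥-elim (<⇒≱ (s≤s (s≤s (s≤s z≤n))) (subst (3 ≤_) sd
                      (symDiff-≥3 (here refl) a∉c* y∉c* (there (here (atom-∉-chain Aa Aa* (a≢a* ∘ sym) a≺y∷rest′))))))
    ... | yes (here y≡𝟘) = ⊥-elim (atom-≼𝟘⇒⊥ 0<n Aa (subst (a ≼_) y≡𝟘 (proj₁ a≺y)))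
    ... | yes (there (here y≡a*)) = ⊥-elim (a≢a* (atom-≼-atom⇒≡ Aa Aa* (subst (a ≼_) y≡a* (proj₁ a≺y))))
    ... | yes (there (there y∈rest*)) = y , rest′ , refl , proj₁ (All.lookup a*≺rest* y∈rest*)

  -- Restricting a shelling

  module _ {B : Pt n → Set} (B? : Decidable B) (B⊆Aall : ∀ {a} → B a → Aall n a)
           (nonempty : ∃[ a ] (B a × InI z a)) where

    HasAtomIn : List (Pt n) → Set
    HasAtomIn c = ∃[ a ] (AtomOf c a × B a)

    HasAtomIn? : Decidable HasAtomIn
    HasAtomIn? []             = no λ { (_ , () , _) }
    HasAtomIn? (_ ∷ [])       = no λ { (_ , () , _) }
    HasAtomIn? (x ∷ a ∷ rest) with B? a
    ... | yes Ba = yes (a , atomOf x a rest , Ba)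
    ... | no ¬Ba = no λ { (_ , atomOf _ _ _ , Ba) → ¬Ba Ba }

    ExchangeProperty : Set
    ExchangeProperty = ∀ {c c*} → MaxChain I⟨Aall⟩ c → HasAtomIn c → MaxChain I⟨Aall⟩ c* → ¬ HasAtomIn c* →
      symDiff c c* ≡ 2 → (∀ a a* → AtomOf c a → AtomOf c* a* → ¬ (a <L a*)) →
      ∃[ c₂ ] (MaxChain (InSub z B) c₂ × (∀ x → x ∈ c → x ∈ c* → x ∈ c₂) × symDiff c c₂ ≡ 2 ×
               ∃[ b ] ∃[ a ] (AtomOf c₂ b × AtomOf c a × b <L a))

    nonempty-Aall : ∃[ a ] (Aall n a × InI z a)
    nonempty-Aall = proj₁ nonempty , B⊆Aall (proj₁ (proj₂ nonempty)) , proj₂ (proj₂ nonempty)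

    maxChain-restriction : ∀ {c} → MaxChain I⟨Aall⟩ c → HasAtomIn c → MaxChain (InSub z B) c
    maxChain-restriction mc hasAtom with maxChain-shape id nonempty-Aall mc
    maxChain-restriction mc (_ , atomOf _ _ _ , Ba) | _ , _ , refl , _ = restrict-maxChain B⊆Aall mc Ba

    maxChain-has-atom : ∀ {c} → MaxChain (InSub z B) c → HasAtomIn c
    maxChain-has-atom mc with maxChain-shape B⊆Aall nonempty mc
    ... | a , rest , refl , Ba , _ = a , atomOf _ a rest , Ba

    restrict-LShellable : ExchangeProperty → LShellable I⟨Aall⟩ → LShellable (InSub z B)
    restrict-LShellable exchange (L , (unique , sound , complete , shelling) , atoms-ordered) =
      F , (Unique.filter⁺ HasAtomIn? unique , sound′ , complete′ , shelling′) , atoms-ordered′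
      where
      F : List (List (Pt n))
      F = filter HasAtomIn? L
      L[_] : Fin (length L) → List (Pt n)
      L[_] = List.lookup L
      F[_] : Fin (length F) → List (Pt n)
      F[_] = List.lookup F
      ι : Fin (length F) → Fin (length L)
      ι = filter-index HasAtomIn? L
      F≡L∘ι : ∀ i → F[ i ] ≡ L[ ι i ]
      F≡L∘ι = lookup-filter HasAtomIn? L

      sound′ : ∀ c → c ∈ F → MaxChain (InSub z B) c
      sound′ c c∈F = let (c∈L , hasAtom) = ∈-filter⁻ HasAtomIn? {xs = L} c∈F in maxChain-restriction (sound c c∈L) hasAtom

      complete′ : ∀ c → MaxChain (InSub z B) c → c ∈ F
      complete′ c mc = ∈-filter⁺ HasAtomIn? (complete c (extend-maxChain B⊆Aall nonempty mc)) (maxChain-has-atom mc)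

      atoms-ordered′ : ∀ i j a′ a → AtomOf F[ i ] a′ → AtomOf F[ j ] a → a′ <L a → toℕ i < toℕ j
      atoms-ordered′ i j a′ a at-i at-j a′<a = filter-index-cancel-< HasAtomIn? L i j
        (atoms-ordered (ι i) (ι j) a′ a (subst (λ c → AtomOf c a′) (F≡L∘ι i) at-i) (subst (λ c → AtomOf c a) (F≡L∘ι j) at-j) a′<a)

      ShellingWitness : Fin (length F) → Fin (length F) → Set
      ShellingWitness i j = ∃[ k ] (toℕ k < toℕ j × (∀ x → x ∈ F[ j ] → x ∈ F[ i ] → x ∈ F[ k ]) × symDiff F[ j ] F[ k ] ≡ 2)

      module _ {i j : Fin (length F)} (K : Fin (length L)) (K<ιj : toℕ K < toℕ (ι j))
               (common : ∀ x → x ∈ L[ ι j ] → x ∈ L[ ι i ] → x ∈ L[ K ]) (sd : symDiff L[ ι j ] L[ K ] ≡ 2) where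

        private
          common-F : ∀ x → x ∈ F[ j ] → x ∈ F[ i ] → x ∈ L[ K ]
          common-F x x∈j x∈i = common x (subst (x ∈_) (F≡L∘ι j) x∈j) (subst (x ∈_) (F≡L∘ι i) x∈i)

        witness-kept : HasAtomIn L[ K ] → ShellingWitness i j
        witness-kept hasAtom with filter-index-surjective HasAtomIn? L K hasAtom
        ... | k , refl = k , filter-index-cancel-< HasAtomIn? L k j K<ιj ,
                         (λ x x∈j x∈i → subst (x ∈_) (sym (F≡L∘ι k)) (common-F x x∈j x∈i)) ,
                         subst₂ (λ c d → symDiff c d ≡ 2) (sym (F≡L∘ι j)) (sym (F≡L∘ι k)) sd

        -- The replacement chain precedes F[ j ] in F because its atom is lexicographically smaller.
        witness-exchanged : ¬ HasAtomIn L[ K ] → ShellingWitness i j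
        witness-exchanged ¬hasAtom
          with exchange (sound _ (∈-lookup (ι j))) hasAtom-j (sound _ (∈-lookup K)) ¬hasAtom sd
                 (λ a a* at at* a<a* → <-asym K<ιj (atoms-ordered (ι j) K a a* at at* a<a*))
          where
          hasAtom-j : HasAtomIn L[ ι j ]
          hasAtom-j = subst HasAtomIn (F≡L∘ι j) (proj₂ (∈-filter⁻ HasAtomIn? {xs = L} (∈-lookup j)))
        ... | c₂ , mc₂ , common₂ , sd₂ , b , a , at-b , at-a , b<a =
          k , atoms-ordered′ k j b a (subst (λ c → AtomOf c b) c₂≡F[k] at-b) (subst (λ c → AtomOf c a) (sym (F≡L∘ι j)) at-a) b<a ,
          (λ x x∈j x∈i → subst (x ∈_) c₂≡F[k] (common₂ x (subst (x ∈_) (F≡L∘ι j) x∈j) (common-F x x∈j x∈i))) ,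
          subst₂ (λ c d → symDiff c d ≡ 2) (sym (F≡L∘ι j)) c₂≡F[k] sd₂
          where
          c₂∈F : c₂ ∈ F
          c₂∈F = complete′ c₂ mc₂
          k : Fin (length F)
          k = Any.index c₂∈F
          c₂≡F[k] : c₂ ≡ F[ k ]
          c₂≡F[k] = lookup-index c₂∈F

      shelling′ : ∀ i j → toℕ i < toℕ j → ShellingWitness i j
      shelling′ i j i<j with shelling (ι i) (ι j) (filter-index-mono-< HasAtomIn? L i j i<j)
      ... | K , K<ιj , common , sd with HasAtomIn? L[ K ]
      ...   | yes hasAtom = witness-kept K K<ιj common sd hasAtom
      ...   | no ¬hasAtom = witness-exchanged K K<ιj common sd ¬hasAtom

  -- The exchange property of A^(ℓ+1)_k

  module _ (3≤n : 3 ≤ n) (ℓ k : ℕ) where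

    exchange-below : ∀ {a a* y rest′} → MaxChain I⟨Aall⟩ (𝟘 n ∷ a ∷ y ∷ rest′) → Aℓk n (suc ℓ) k a →
                     Aall n a* → ¬ Aℓk n (suc ℓ) k a* → a* <L a → a* ≼ y →
                     ∃[ b ] (Aall n b × b <L a × MaxChain (InSub z (Aℓk n (suc ℓ) k)) (𝟘 n ∷ b ∷ y ∷ rest′))
    exchange-below {a} {a*} {y} mc@(_ ∷ _ ∷ y∈A ∷ _ , _ ∷ (a≺y ∷ _) ∷ _ , _) Ba Aa* ¬Ba* a*<a a*≼y
      with positive-tail (proj₁ Ba)
    ... | q , ℓ≤q , 1≤a!q with exchange-atom 3≤n Aa* a*-zero-tail (proj₁ a*≼y) ℓ≤q (≤-trans 1≤a!q (proj₁ (proj₁ a≺y) q))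
      where
      a*-zero-tail : ∀ i → ℓ ≤ toℕ i → a* ! i ≡ 0
      a*-zero-tail = zero-tail Aa* (λ Aℓa* → ¬Ba* (Aℓk-downward-closed Ba Aℓa* a*<a))
    ...   | b , Ab , b≼y , b<a* , 1≤b!q =
      b , Ab , b<a , replace-atom (proj₁ ∘ proj₁) 3≤n (proj₁ (proj₁ Ba)) mc Bb b∈I b≼y b≢a
      where
      b<a : b <L a
      b<a = <L-trans {a = b} {a*} {a} b<a* a*<a
      b≢a : b ≢ a
      b≢a refl = <L-irrefl {a = a} b<a
      Bb : Aℓk n (suc ℓ) k b
      Bb = Aℓk-downward-closed Ba (Ab , λ tail≡0 → <-irrefl (sym (tail≡0 q (s≤s ℓ≤q))) 1≤b!q) b<a
      b∈I : InI z b
      b∈I = atom-∈V Ab , 𝟘≼ (proj₂ Ab) , ≼-trans (proj₁ (atom-∈V Ab)) (InSub-∣ y∈A) b≼y (InSub-≼z y∈A)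

    exchange-chain : ∀ {a a* rest rest*} →
                     MaxChain I⟨Aall⟩ (𝟘 n ∷ a ∷ rest) → Aℓk n (suc ℓ) k a →
                     MaxChain I⟨Aall⟩ (𝟘 n ∷ a* ∷ rest*) → ¬ Aℓk n (suc ℓ) k a* → ¬ (a <L a*) →
                     symDiff (𝟘 n ∷ a ∷ rest) (𝟘 n ∷ a* ∷ rest*) ≡ 2 →
                     ∃[ b ] (Aall n b × b <L a × MaxChain (InSub z (Aℓk n (suc ℓ) k)) (𝟘 n ∷ b ∷ rest))
    exchange-chain {a} {a*} mc Ba mc* ¬Ba* a≮a* sd
      with maxChain-shape id (a , Aa , a∈I) mc*
      where
      Aa : Aall n a
      Aa = proj₁ (proj₁ Ba)
      a∈I : InI z a
      a∈I = above-atom⇒InI (All.lookup (proj₁ mc) (there (here refl))) Aa (≼-refl 0<n a)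
    ... | _ , _ , refl , Aa* , _ with <L-trichotomy a a* (λ { refl → ¬Ba* Ba })
    ...   | inj₁ a<a* = ⊥-elim (a≮a* a<a*)
    ...   | inj₂ a*<a with adjacent-maxChains (proj₁ (proj₁ Ba)) Aa* (λ { refl → ¬Ba* Ba }) mc mc* sd
    ...     | y , rest′ , refl , a*≼y = exchange-below mc Ba Aa* ¬Ba* a*<a a*≼y

    Aℓk-exchange : (B? : Decidable (Aℓk n (suc ℓ) k)) (nonempty : ∃[ a ] (Aℓk n (suc ℓ) k a × InI z a)) →
                   ExchangeProperty B? (proj₁ ∘ proj₁) nonempty
    Aℓk-exchange B? nonempty mc hasAtom mc* ¬hasAtom* sd ordered
      with maxChain-shape id (nonempty-Aall B? (proj₁ ∘ proj₁) nonempty) mc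
         | maxChain-shape id (nonempty-Aall B? (proj₁ ∘ proj₁) nonempty) mc*
    ... | a , rest , refl , Aa , _ | a* , rest* , refl , Aa* , _ with hasAtom
    ...   | _ , atomOf _ _ _ , Ba
      with exchange-chain mc Ba mc* (λ Ba* → ¬hasAtom* (a* , atomOf _ _ _ , Ba*)) (ordered a a* (atomOf _ _ _) (atomOf _ _ _)) sd
    ...     | b , Ab , b<a , mc₂@(_ , _ ∷ (b≺rest ∷ _) , _) =
      𝟘 n ∷ b ∷ rest , mc₂ , common , symDiff-swap a∉c₂ b∉c , b , a , atomOf _ _ _ , atomOf _ _ _ , b<a
      where
      b≢a : b ≢ a
      b≢a refl = <L-irrefl {a = a} b<a
      a∉c₂ : a ∉ 𝟘 n ∷ b ∷ rest
      a∉c₂ = atom-∉-chain Ab Aa (b≢a ∘ sym) b≺rest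
      b∉c : b ∉ 𝟘 n ∷ a ∷ rest
      b∉c = atom-∉-chain Aa Ab b≢a (AllPairs.head (AllPairs.tail (proj₁ (proj₂ mc))))
      common : ∀ x → x ∈ 𝟘 n ∷ a ∷ rest → x ∈ 𝟘 n ∷ a* ∷ rest* → x ∈ 𝟘 n ∷ b ∷ rest
      common x (here x≡𝟘)         _    = here x≡𝟘
      common x (there (here refl)) x∈c* = ⊥-elim (atom-∉-chain Aa* Aa a≢a* (AllPairs.head (AllPairs.tail (proj₁ (proj₂ mc*)))) x∈c*)
        where
        a≢a* : a ≢ a*
        a≢a* refl = ¬hasAtom* (a , atomOf _ _ _ , Ba)
      common x (there (there x∈)) _ = there (there x∈)

lemma5 : (n : ℕ) → 4 ≤ n → (z : Pt n) → InV n z →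
    (ℓ : ℕ) → 1 ≤ ℓ → ℓ ≤ n ∸ 1 →
    (k : ℕ) → 1 ≤ k → ∃[ m ] (HasCard (Aℓ n (suc ℓ)) m × k ≤ m) →
    ((∃[ a ] (Aall n a × InI z a)) → LShellable (InSub z (Aall n))) →
    (∃[ a ] (Aℓk n (suc ℓ) k a × InI z a)) → LShellable (InSub z (Aℓk n (suc ℓ) k))
lemma5 n 4≤n z z∈V ℓ _ _ k _ (_ , hcA , _) full-shellable nonempty =
  restrict-LShellable B? B⊆Aall nonempty (Aℓk-exchange 3≤n ℓ k B? nonempty)
    (full-shellable (nonempty-Aall B? B⊆Aall nonempty))
  where
  3≤n : 3 ≤ n
  3≤n = ≤-trans (n≤1+n 3) 4≤n
  open Chains (≤-trans (s≤s z≤n) 3≤n) z z∈V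
  B? : Decidable (Aℓk n (suc ℓ) k)
  B? = Aℓk? (suc ℓ) k hcA
  B⊆Aall : ∀ {a} → Aℓk n (suc ℓ) k a → Aall n a
  B⊆Aall = proj₁ ∘ proj₁
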